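{- For any $p\in\mathrm{OFS}(\mathbb{Z}^+)$, $f(p)\ge\max(p)$. Furthermore, if $|p|>1$, then $f(p)\ge 2p_1$.
   Context: $\mathrm{OFS}(\mathbb{Z}^+)$ denotes the set of all nonempty strictly increasing finite sequences of positive integers. For $p\in\mathrm{OFS}(\mathbb{Z}^+)$, $|p|$ is its length, $p_i$ its $i$-th entry, $\max(p)=p_{|p|}$. The map $R$: $R(p)=p$ if $|p|=1$; if $n=|p|>1$, form $(p_2-p_1,\ldots,p_n-p_1)$ and, if $p_1$ does not appear in it, insert $p_1$ so that the result is strictly increasing. $f$ is defined recursively by $f(p)=p_1$ if $|p|=1$ and $f(p)=p_1+f(R(p))$ if $|p|>1$. -}

module Defs where

open import Data.Nat using (ℕ; zero; suc; _+_; _∸_; _<_; _<?_; _≟_)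
open import Data.List using (List; []; _∷_; map; length)
open import Data.List.Relation.Unary.All using (All)
open import Data.List.Relation.Unary.Any using (any?)
open import Data.List.Relation.Unary.Linked using (Linked)
open import Relation.Nullary using (yes; no)
open import Data.Product using (_×_)

-- OFS(ℤ⁺): nonempty strictly increasing finite sequences of positive integers,
-- represented as lists of naturals satisfying the predicate OFS.
NonEmpty : List ℕ → Set
NonEmpty p = 0 < length p

OFS : List ℕ → Set
OFS p = NonEmpty p × All (0 <_) p × Linked _<_ p

-- p₁ (first entry; junk value 0 on the empty list)
first : List ℕ → ℕ
first []      = 0
first (x ∷ _) = x

-- max(p) = last entry (junk value 0 on the empty list)
maxOf : List ℕ → ℕ
maxOf []           = 0
maxOf (x ∷ [])     = x
maxOf (_ ∷ y ∷ ys) = maxOf (y ∷ ys)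

insert : ℕ → List ℕ → List ℕ
insert a []       = a ∷ []
insert a (x ∷ xs) with a <? x
... | yes _ = a ∷ x ∷ xs
... | no  _ = x ∷ insert a xs

R : List ℕ → List ℕ
R []           = []
R (a ∷ [])     = a ∷ []
R (a ∷ b ∷ bs) with any? (a ≟_) d
  where d = map (λ x → x ∸ a) (b ∷ bs)
... | yes _ = map (λ x → x ∸ a) (b ∷ bs)
... | no  _ = insert a (map (λ x → x ∸ a) (b ∷ bs))

-- f with an explicit fuel bound (the recursion terminates because max
-- strictly decreases under R when |p| > 1; fuel max(p) always suffices
-- for p ∈ OFS(ℤ⁺)).
fFuel : ℕ → List ℕ → ℕ
fFuel zero    _            = 0
fFuel (suc k) []           = 0
fFuel (suc k) (a ∷ [])     = a
fFuel (suc k) (a ∷ b ∷ bs) = a + fFuel k (R (a ∷ b ∷ bs))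

f : List ℕ → ℕ
f p = fFuel (maxOf p) p

module Submission where

-- Call a list q "admissible for k" when its entries are
-- positive, strictly increasing and at most k.  The map R sends a list
-- a ∷ t (t nonempty, admissible for k + 1) to a list admissible for k:
-- its entries are a itself and the differences y ∸ a for y ∈ t, all
-- positive, at most k, and still strictly increasing (insert puts a in
-- place, and only when it is not already a difference).
--
-- Key invariant: if q is admissible for k, every entry of q is at most
-- fFuel k q.  By induction on the fuel k: fFuel (k + 1) (a ∷ t) =
-- a + fFuel k (R (a ∷ t)), and for y ∈ a ∷ t we have y ≤ a + (y ∸ a) with
-- y ∸ a an entry of R (a ∷ t) (or 0 when y = a).
--
-- A strictly increasing positive p is admissible for maxOf p, which is
-- an entry of p; so maxOf p ≤ f p.  If |p| ≥ 2 then p₁ itself is an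
-- entry of R p, hence f p = p₁ + fFuel _ (R p) ≥ p₁ + p₁.

open import Defs
open import Data.Nat using (ℕ; zero; suc; _+_; _*_; _∸_; _≤_; _<_; _<?_; _≟_; z≤n; s≤s)
open import Data.Nat.Properties
  using (≤-refl; <-trans; ≤-trans; <⇒≤; <-≤-trans; <-irrefl; <-cmp; ≤-pred;
         m≤m+n; m≤n+m∸n; +-monoʳ-≤; +-identityʳ; ∸-mono; ∸-monoˡ-<; m<n⇒0<n∸m)
open import Data.List using (List; []; _∷_; map; length)
open import Data.List.Relation.Unary.All as All using (All; []; _∷_)
open import Data.List.Relation.Unary.AllPairs using (AllPairs; []; _∷_)
open import Data.List.Relation.Unary.Any using (here; there; any?)
open import Data.List.Relation.Unary.Linked.Properties using (Linked⇒AllPairs)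
open import Data.List.Membership.Propositional using (_∈_; _∉_)
open import Data.List.Membership.Propositional.Properties using (∈-map⁺; ∈-map⁻)
open import Data.Product using (_×_; _,_; ∃-syntax)
open import Data.Sum using (_⊎_; inj₁; inj₂)
open import Data.Empty using (⊥-elim)
open import Relation.Nullary using (yes; no)
open import Relation.Binary using (tri<; tri≈; tri>)
open import Relation.Binary.PropositionalEquality using (_≡_; refl; sym; subst)

Increasing : List ℕ → Set
Increasing = AllPairs _<_

∈-insert-self : ∀ a l → a ∈ insert a l
∈-insert-self a []       = here refl
∈-insert-self a (x ∷ xs) with a <? x
... | yes _ = here refl
... | no  _ = there (∈-insert-self a xs)

∈-insert⁺ : ∀ a {y} l → y ∈ l → y ∈ insert a l
∈-insert⁺ a (x ∷ xs) y∈l with a <? x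
... | yes _ = there y∈l
∈-insert⁺ a (x ∷ xs) (here y≡x)  | no _ = here y≡x
∈-insert⁺ a (x ∷ xs) (there y∈xs) | no _ = there (∈-insert⁺ a xs y∈xs)

∈-insert⁻ : ∀ a {y} l → y ∈ insert a l → y ≡ a ⊎ y ∈ l
∈-insert⁻ a []       (here y≡a) = inj₁ y≡a
∈-insert⁻ a (x ∷ xs) y∈ins with a <? x
∈-insert⁻ a (x ∷ xs) (here y≡a)  | yes _ = inj₁ y≡a
∈-insert⁻ a (x ∷ xs) (there y∈l) | yes _ = inj₂ y∈l
∈-insert⁻ a (x ∷ xs) (here y≡x)  | no  _ = inj₂ (here y≡x)
∈-insert⁻ a (x ∷ xs) (there y∈i) | no  _ with ∈-insert⁻ a xs y∈i
... | inj₁ y≡a  = inj₁ y≡a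
... | inj₂ y∈xs = inj₂ (there y∈xs)

insert-All : ∀ {P : ℕ → Set} a l → P a → All P l → All P (insert a l)
insert-All {P} a l pa pl = All.tabulate entry
  where
  entry : ∀ {y} → y ∈ insert a l → P y
  entry y∈ with ∈-insert⁻ a l y∈
  ... | inj₁ refl = pa
  ... | inj₂ y∈l  = All.lookup pl y∈l

insert-increasing : ∀ a l → a ∉ l → Increasing l → Increasing (insert a l)
insert-increasing a []       _   _            = [] ∷ []
insert-increasing a (x ∷ xs) a∉l (x<xs ∷ inc) with a <? x
... | yes a<x = (a<x ∷ All.map (<-trans a<x) x<xs) ∷ x<xs ∷ inc
... | no  a≮x = insert-All a xs x<a x<xs ∷ insert-increasing a xs (λ a∈xs → a∉l (there a∈xs)) inc
  where
  x<a : x < a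
  x<a with <-cmp x a
  ... | tri< x<a _ _ = x<a
  ... | tri≈ _ x≡a _ = ⊥-elim (a∉l (here (sym x≡a)))
  ... | tri> _ _ a<x = ⊥-elim (a≮x a<x)

shift-increasing : ∀ a l → All (a <_) l → Increasing l →
                   Increasing (map (λ x → x ∸ a) l)
shift-increasing a []       _           _            = []
shift-increasing a (x ∷ xs) (a<x ∷ a<xs) (x<xs ∷ inc) =
  shifted xs a<xs x<xs ∷ shift-increasing a xs a<xs inc
  where
  shifted : ∀ ys → All (a <_) ys → All (x <_) ys → All (x ∸ a <_) (map (λ y → y ∸ a) ys)
  shifted []       _          _          = []
  shifted (y ∷ ys) (_ ∷ a<ys) (x<y ∷ x<ys) = ∸-monoˡ-< x<y (<⇒≤ a<x) ∷ shifted ys a<ys x<ys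

∈-R-self : ∀ a b bs → a ∈ R (a ∷ b ∷ bs)
∈-R-self a b bs with any? (a ≟_) (map (λ x → x ∸ a) (b ∷ bs))
... | yes a∈shift = a∈shift
... | no  _       = ∈-insert-self a _

∈-R-shift : ∀ a b bs {y} → y ∈ b ∷ bs → y ∸ a ∈ R (a ∷ b ∷ bs)
∈-R-shift a b bs y∈t with any? (a ≟_) (map (λ x → x ∸ a) (b ∷ bs))
... | yes _ = ∈-map⁺ (λ x → x ∸ a) y∈t
... | no  _ = ∈-insert⁺ a _ (∈-map⁺ (λ x → x ∸ a) y∈t)

∈-R⁻ : ∀ a b bs {z} → z ∈ R (a ∷ b ∷ bs) → z ≡ a ⊎ ∃[ y ] (y ∈ b ∷ bs × z ≡ y ∸ a)
∈-R⁻ a b bs z∈R with any? (a ≟_) (map (λ x → x ∸ a) (b ∷ bs))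
... | yes _ = inj₂ (∈-map⁻ (λ x → x ∸ a) z∈R)
... | no  _ with ∈-insert⁻ a _ z∈R
...   | inj₁ z≡a     = inj₁ z≡a
...   | inj₂ z∈shift = inj₂ (∈-map⁻ (λ x → x ∸ a) z∈shift)

R-increasing : ∀ a b bs → All (a <_) (b ∷ bs) → Increasing (b ∷ bs) →
               Increasing (R (a ∷ b ∷ bs))
R-increasing a b bs a<t inc with any? (a ≟_) (map (λ x → x ∸ a) (b ∷ bs))
... | yes _    = shift-increasing a _ a<t inc
... | no  a∉sh = insert-increasing a _ a∉sh (shift-increasing a _ a<t inc)

record Admissible (k : ℕ) (q : List ℕ) : Set where
  constructor admissible
  field
    positive   : All (0 <_) q
    increasing : Increasing q
    bounded    : All (_≤ k) q

R-admissible : ∀ k a b bs → Admissible (suc k) (a ∷ b ∷ bs) → Admissible k (R (a ∷ b ∷ bs))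
R-admissible k a b bs (admissible (0<a ∷ _) (a<t@(a<b ∷ _) ∷ inc) (_ ∷ t≤@(b≤ ∷ _))) =
  admissible (All.tabulate positive) (R-increasing a b bs a<t inc) (All.tabulate bounded)
  where
  positive : ∀ {z} → z ∈ R (a ∷ b ∷ bs) → 0 < z
  positive z∈R with ∈-R⁻ a b bs z∈R
  ... | inj₁ refl            = 0<a
  ... | inj₂ (y , y∈t , refl) = m<n⇒0<n∸m (All.lookup a<t y∈t)
  bounded : ∀ {z} → z ∈ R (a ∷ b ∷ bs) → z ≤ k
  bounded z∈R with ∈-R⁻ a b bs z∈R
  ... | inj₁ refl            = ≤-pred (<-≤-trans a<b b≤)
  ... | inj₂ (y , y∈t , refl) = ∸-mono (All.lookup t≤ y∈t) 0<a

entries≤fFuel : ∀ k q → Admissible k q → All (_≤ fFuel k q) q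
entries≤fFuel zero    q            adm = Admissible.bounded adm
entries≤fFuel (suc k) []           _   = []
entries≤fFuel (suc k) (a ∷ [])     _   = ≤-refl ∷ []
entries≤fFuel (suc k) (a ∷ b ∷ bs) adm = m≤m+n a F ∷ All.tabulate tail≤
  where
  F : ℕ
  F = fFuel k (R (a ∷ b ∷ bs))
  entriesR≤F : All (_≤ F) (R (a ∷ b ∷ bs))
  entriesR≤F = entries≤fFuel k (R (a ∷ b ∷ bs)) (R-admissible k a b bs adm)
  tail≤ : ∀ {y} → y ∈ b ∷ bs → y ≤ a + F
  tail≤ {y} y∈t = ≤-trans (m≤n+m∸n y a) (+-monoʳ-≤ a (All.lookup entriesR≤F (∈-R-shift a b bs y∈t)))

double-first≤fFuel : ∀ k a b bs → Admissible k (a ∷ b ∷ bs) → 2 * a ≤ fFuel k (a ∷ b ∷ bs)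
double-first≤fFuel zero a b bs (admissible (_ ∷ 0<b ∷ _) _ (_ ∷ b≤0 ∷ _)) =
  ⊥-elim (<-irrefl refl (<-≤-trans 0<b b≤0))
double-first≤fFuel (suc k) a b bs adm =
  +-monoʳ-≤ a (subst (_≤ F) (sym (+-identityʳ a)) a≤F)
  where
  -- 2 * a unfolds to a + (a + 0), and a is an entry of R (a ∷ b ∷ bs)
  F : ℕ
  F = fFuel k (R (a ∷ b ∷ bs))
  a≤F : a ≤ F
  a≤F = All.lookup (entries≤fFuel k _ (R-admissible k a b bs adm)) (∈-R-self a b bs)

maxOf-∈ : ∀ p → 0 < length p → maxOf p ∈ p
maxOf-∈ (x ∷ [])     _ = here refl
maxOf-∈ (x ∷ y ∷ ys) _ = there (maxOf-∈ (y ∷ ys) (s≤s z≤n))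

entries≤maxOf : ∀ p → Increasing p → All (_≤ maxOf p) p
entries≤maxOf []           _                   = []
entries≤maxOf (x ∷ [])     _                   = ≤-refl ∷ []
entries≤maxOf (x ∷ y ∷ ys) ((x<y ∷ _) ∷ inc) with entries≤maxOf (y ∷ ys) inc
... | y≤ ∷ ys≤ = <⇒≤ (<-≤-trans x<y y≤) ∷ y≤ ∷ ys≤

lemma3 : (p : List ℕ) → OFS p →
         (maxOf p ≤ f p) × (2 ≤ length p → 2 * first p ≤ f p)
lemma3 p (nonempty , pos , linked) = max≤f , double-first≤f p adm
  where
  inc : Increasing p
  inc = Linked⇒AllPairs <-trans linked
  adm : Admissible (maxOf p) p
  adm = admissible pos inc (entries≤maxOf p inc)
  max≤f : maxOf p ≤ f p
  max≤f = All.lookup (entries≤fFuel (maxOf p) p adm) (maxOf-∈ p nonempty)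
  double-first≤f : ∀ q → Admissible (maxOf q) q → 2 ≤ length q → 2 * first q ≤ f q
  double-first≤f (a ∷ b ∷ bs) admq _ = double-first≤fFuel (maxOf (a ∷ b ∷ bs)) a b bs admq
  double-first≤f (a ∷ [])     _    (s≤s ())
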